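{- Let $n\ge1$ and $0\le K\le n$ be integers, and let $\gamma,\delta$ be 0-1 vectors of length $n$ with $\sum_i\gamma_i=\sum_i\delta_i=n-K$. Then the instance $ASM(\gamma,\delta)$ of 3-CCP is consistent if and only if $\gamma\succeq\overleftarrow{\delta}$.
   Context: 3-CCP: there are three atom types $A,B,C$ (azure, beige, cyan). An instance of size $N$ gives, for each atom type, a row-sum vector and a column-sum vector of length $N$; a realization is an $N\times N$ matrix with entries in $\{A,B,C,\Box\}$ ($\Box$ = empty) in which each row and each column contains exactly the prescribed number of atoms of each type; the instance is consistent if it has a realization. The azure skew mirror $ASM(\gamma,\delta)$ (depending also on $n$ and $K$) is the $(n+2)\times(n+2)$ instance with zero cyan sums, azure row sums $x^A$ and column sums $y^A$ given by $x^A_i=y^A_i=i$ for $i=1,\dots,n$, $x^A_{n+1}=y^A_{n+1}=0$, $x^A_{n+2}=y^A_{n+2}=K$, and beige row sums $x^B$ and column sums $y^B$ given by $x^B_i=\gamma_i$, $y^B_i=\delta_i$ for $i=1,\dots,n$, $x^B_{n+1}=y^B_{n+1}=2$, $x^B_{n+2}=y^B_{n+2}=n-K+2$. Reverse: $\overleftarrow{\delta}_i=\delta_{n-i+1}$. Minorization: $\alpha\preceq\beta$ (equivalently $\beta\succeq\alpha$) if $\sum_{i=1}^k\alpha_i\le\sum_{i=1}^k\beta_i$ for all $k$. -}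

module Defs where

open import Data.Nat using (ℕ; zero; suc; _+_; _∸_; _≤_)
open import Data.Fin using (Fin; toℕ; opposite)
open import Data.Fin.Base using () renaming (zero to fz; suc to fs)
open import Data.Product using (Σ; _×_)
open import Relation.Binary.PropositionalEquality using (_≡_)

data Cell : Set where
  A B C □ : Cell

data Atom : Set where
  azure beige cyan : Atom

atomCell : Atom → Cell
atomCell azure = A
atomCell beige = B
atomCell cyan  = C

isCell : Cell → Cell → ℕ
isCell A A = 1
isCell B B = 1
isCell C C = 1
isCell □ □ = 1
isCell _ _ = 0

sumFin : (n : ℕ) → (Fin n → ℕ) → ℕ
sumFin zero    f = 0
sumFin (suc n) f = f fz + sumFin n (λ i → f (fs i))

record Instance (N : ℕ) : Set where
  field
    rowSum : Atom → Fin N → ℕ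
    colSum : Atom → Fin N → ℕ

Matrix : ℕ → Set
Matrix N = Fin N → Fin N → Cell

rowCount : {N : ℕ} → Matrix N → Atom → Fin N → ℕ
rowCount {N} M t i = sumFin N (λ j → isCell (atomCell t) (M i j))

colCount : {N : ℕ} → Matrix N → Atom → Fin N → ℕ
colCount {N} M t j = sumFin N (λ i → isCell (atomCell t) (M i j))

IsRealization : {N : ℕ} → Instance N → Matrix N → Set
IsRealization {N} I M =
  ((t : Atom) (i : Fin N) → rowCount M t i ≡ Instance.rowSum I t i) ×
  ((t : Atom) (j : Fin N) → colCount M t j ≡ Instance.colSum I t j)

Consistent : {N : ℕ} → Instance N → Set
Consistent {N} I = Σ (Matrix N) (IsRealization I)

Is01 : {n : ℕ} → (Fin n → ℕ) → Set
Is01 {n} v = (i : Fin n) → v i ≤ 1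

rev : {n : ℕ} → (Fin n → ℕ) → Fin n → ℕ
rev δ i = δ (opposite i)

prefixSum : {n : ℕ} → (Fin n → ℕ) → ℕ → ℕ
prefixSum {zero}  v k       = 0
prefixSum {suc n} v zero    = 0
prefixSum {suc n} v (suc k) = v fz + prefixSum (λ i → v (fs i)) k

_⪯_ : {n : ℕ} → (Fin n → ℕ) → (Fin n → ℕ) → Set
_⪯_ {n} α β = (k : ℕ) → k ≤ n → prefixSum α k ≤ prefixSum β k

-- A vector of length n+2 given by entries 1..n from v (0-based index
-- i < n gives v i), then entry n+1 = a, entry n+2 = b.
extend2 : {n : ℕ} → (Fin n → ℕ) → ℕ → ℕ → Fin (suc (suc n)) → ℕ
extend2 {zero}  v a b fz          = a
extend2 {zero}  v a b (fs fz)     = b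
extend2 {suc n} v a b fz          = v fz
extend2 {suc n} v a b (fs i)      = extend2 (λ j → v (fs j)) a b i

-- azure vector: x_i = i (1-based), i.e. toℕ i + 1 for 0-based i
azureBase : (n : ℕ) → Fin n → ℕ
azureBase n i = suc (toℕ i)

ASM : (n K : ℕ) → (γ δ : Fin n → ℕ) → Instance (suc (suc n))
Instance.rowSum (ASM n K γ δ) azure = extend2 (azureBase n) 0 K
Instance.rowSum (ASM n K γ δ) beige = extend2 γ 2 ((n ∸ K) + 2)
Instance.rowSum (ASM n K γ δ) cyan  = λ _ → 0
Instance.colSum (ASM n K γ δ) azure = extend2 (azureBase n) 0 K
Instance.colSum (ASM n K γ δ) beige = extend2 δ 2 ((n ∸ K) + 2)
Instance.colSum (ASM n K γ δ) cyan  = λ _ → 0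

module Submission where

-- Row n+2 and column n+2 of a realization are full (K azure plus n − K + 2 beige atoms
-- in n + 2 cells) and their beige atoms are forced onto the ones of δ, resp. γ, while
-- row and column n+1 contain no azure atom. Hence a realization restricts to an n × n
-- 0-1 core whose row i and column j contain i + γ i and j + δ j azure atoms (0-based),
-- and conversely every core extends to a realization.
--
-- A core exists iff rev δ ⪯ γ. Counting the azure atoms in the last k columns of a core
-- by columns gives Σ_{m<k} (n − 1 − m) + Σ_{m<k} (rev δ) m, counting them by rows gives
-- at most Σ_i min(i, k) + Σ_{i<k} γ i, and the two index sums are equal.
-- Conversely, the cells with i + j ≥ n together with the cells pairing the t-th one of
-- γ with the t-th one of rev δ form a core: minorization keeps the paired cells off
-- the staircase i + j ≥ n.

open import Defs
open import Data.Bool.Base using (true; false; if_then_else_)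
open import Data.Fin.Base using (Fin; zero; suc; toℕ; opposite)
open import Data.Fin.Permutation using (reverse)
open import Data.Fin.Properties
  using (toℕ<n; toℕ-fromℕ; opposite-prop; opposite-suc; opposite-involutive)
open import Data.Nat.Base using (ℕ; zero; suc; _+_; _*_; _∸_; _⊓_; _≤_; _<_; z≤n; s≤s; z<s)
open import Data.Nat.Properties
open import Data.Product using (∃; _×_; _,_; proj₁; proj₂)
open import Function.Base using (_∘_; flip)
open import Function.Bundles using (_⇔_; mk⇔)
open import Relation.Nullary.Decidable using (Dec; does; yes; no; dec-true; dec-false)
open import Relation.Nullary.Negation using (¬_)
open import Relation.Binary.PropositionalEquality
open import Algebra.Properties.CommutativeSemigroup +-commutativeSemigroup
  using () renaming (interchange to +-interchange)
open import Algebra.Properties.Semiring.Sum +-*-semiring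
  using (sum; sum-cong-≗; sum-replicate-zero; ∑-distrib-+; *-distribˡ-sum; sum-permute)

𝟙 : ∀ {p} {P : Set p} → Dec P → ℕ
𝟙 d = if does d then 1 else 0

𝟙-yes : ∀ {p} {P : Set p} (d : Dec P) → P → 𝟙 d ≡ 1
𝟙-yes d p = cong (λ b → if b then 1 else 0) (dec-true d p)

𝟙-no : ∀ {p} {P : Set p} (d : Dec P) → ¬ P → 𝟙 d ≡ 0
𝟙-no d ¬p = cong (λ b → if b then 1 else 0) (dec-false d ¬p)

𝟙≤1 : ∀ {p} {P : Set p} (d : Dec P) → 𝟙 d ≤ 1
𝟙≤1 d with does d
... | true  = s≤s z≤n
... | false = z≤n

𝟙-⇔ : ∀ {p q} {P : Set p} {Q : Set q} → (P → Q) → (Q → P) → (d : Dec P) (e : Dec Q) →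
      𝟙 d ≡ 𝟙 e
𝟙-⇔ P⇒Q Q⇒P (yes p) e = sym (𝟙-yes e (P⇒Q p))
𝟙-⇔ P⇒Q Q⇒P (no ¬p) e = sym (𝟙-no e (¬p ∘ Q⇒P))

m*𝟙≡m : ∀ m {p} {P : Set p} (d : Dec P) → (0 < m → P) → m * 𝟙 d ≡ m
m*𝟙≡m zero    d _ = refl
m*𝟙≡m (suc m) d p = trans (cong (suc m *_) (𝟙-yes d (p z<s))) (*-identityʳ (suc m))

sumFin≡sum : ∀ n (f : Fin n → ℕ) → sumFin n f ≡ sum f
sumFin≡sum zero    f = refl
sumFin≡sum (suc n) f = cong (f zero +_) (sumFin≡sum n (f ∘ suc))

sum-zero : ∀ {n} {f : Fin n → ℕ} → (∀ i → f i ≡ 0) → sum f ≡ 0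
sum-zero {n} f≗0 = trans (sum-cong-≗ f≗0) (sum-replicate-zero n)

sum-ones : ∀ n → sum {n} (λ _ → 1) ≡ n
sum-ones zero    = refl
sum-ones (suc n) = cong suc (sum-ones n)

sum-suc : ∀ {n} (f : Fin n → ℕ) → sum (λ i → suc (f i)) ≡ n + sum f
sum-suc {n} f = trans (∑-distrib-+ (λ _ → 1) f) (cong (_+ sum f) (sum-ones n))

sum-mono-≤ : ∀ {n} {f g : Fin n → ℕ} → (∀ i → f i ≤ g i) → sum f ≤ sum g
sum-mono-≤ {zero}  _   = z≤n
sum-mono-≤ {suc n} f≤g = +-mono-≤ (f≤g zero) (sum-mono-≤ (f≤g ∘ suc))

term≤sum : ∀ {n} (f : Fin n → ℕ) i → f i ≤ sum f
term≤sum f zero    = m≤m+n _ _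
term≤sum f (suc i) = ≤-trans (term≤sum (f ∘ suc) i) (m≤n+m _ _)

sum-≤⇒≗ : ∀ {n} {f g : Fin n → ℕ} → (∀ i → f i ≤ g i) → sum g ≤ sum f → ∀ i → f i ≡ g i
sum-≤⇒≗ {suc n} {f} {g} f≤g Σg≤Σf zero = ≤-antisym (f≤g zero)
  (+-cancelʳ-≤ _ _ _ (≤-trans Σg≤Σf (+-monoʳ-≤ (f zero) (sum-mono-≤ (f≤g ∘ suc)))))
sum-≤⇒≗ {suc n} {f} {g} f≤g Σg≤Σf (suc i) = sum-≤⇒≗ (f≤g ∘ suc)
  (+-cancelˡ-≤ (g zero) _ _ (≤-trans Σg≤Σf (+-monoˡ-≤ _ (f≤g zero)))) i

count-below : ∀ {n} (i : Fin n) → sum {n} (λ m → 𝟙 (toℕ m <? toℕ i)) ≡ toℕ i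
count-below {suc n} zero    = sum-replicate-zero (suc n)
count-below {suc n} (suc i) = cong suc (count-below i)

count-above : ∀ {n} (m : Fin n) → sum {n} (λ i → 𝟙 (toℕ m <? toℕ i)) ≡ toℕ (opposite m)
count-above m = trans (count-above′ m) (sym (opposite-prop m))
  where
  count-above′ : ∀ {n} (m : Fin n) → sum {n} (λ i → 𝟙 (toℕ m <? toℕ i)) ≡ n ∸ suc (toℕ m)
  count-above′ {suc n} zero    = sum-ones n
  count-above′ {suc n} (suc m) = count-above′ m

prefixSum-zero : ∀ {n} (v : Fin n → ℕ) → prefixSum v 0 ≡ 0
prefixSum-zero {zero}  v = refl
prefixSum-zero {suc n} v = refl

prefixSum-cong : ∀ {n} {v w : Fin n → ℕ} → (∀ i → v i ≡ w i) → ∀ k →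
                 prefixSum v k ≡ prefixSum w k
prefixSum-cong {zero}  v≗w k       = refl
prefixSum-cong {suc n} v≗w zero    = refl
prefixSum-cong {suc n} v≗w (suc k) = cong₂ _+_ (v≗w zero) (prefixSum-cong (v≗w ∘ suc) k)

prefixSum-monoʳ-≤ : ∀ {n} (v : Fin n → ℕ) {k l} → k ≤ l → prefixSum v k ≤ prefixSum v l
prefixSum-monoʳ-≤ {zero}  v _         = z≤n
prefixSum-monoʳ-≤ {suc n} v z≤n       = z≤n
prefixSum-monoʳ-≤ {suc n} v (s≤s k≤l) = +-monoʳ-≤ (v zero) (prefixSum-monoʳ-≤ (v ∘ suc) k≤l)

prefixSum≤sum : ∀ {n} (v : Fin n → ℕ) k → prefixSum v k ≤ sum v
prefixSum≤sum {zero}  v k       = z≤n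
prefixSum≤sum {suc n} v zero    = z≤n
prefixSum≤sum {suc n} v (suc k) = +-monoʳ-≤ (v zero) (prefixSum≤sum (v ∘ suc) k)

prefixSum≤length : ∀ {n} {v : Fin n → ℕ} → Is01 v → ∀ k → prefixSum v k ≤ k
prefixSum≤length {zero}  v01 k       = z≤n
prefixSum≤length {suc n} v01 zero    = z≤n
prefixSum≤length {suc n} v01 (suc k) = +-mono-≤ (v01 zero) (prefixSum≤length (v01 ∘ suc) k)

prefixSum-suc : ∀ {n} (v : Fin n → ℕ) i → prefixSum v (suc (toℕ i)) ≡ prefixSum v (toℕ i) + v i
prefixSum-suc v zero    =
  trans (cong (v zero +_) (prefixSum-zero (v ∘ suc))) (+-identityʳ (v zero))
prefixSum-suc v (suc i) =
  trans (cong (v zero +_) (prefixSum-suc (v ∘ suc) i)) (sym (+-assoc (v zero) _ _))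

prefixSum-+ : ∀ {n} (v w : Fin n → ℕ) k →
              prefixSum (λ i → v i + w i) k ≡ prefixSum v k + prefixSum w k
prefixSum-+ {zero}  v w k       = refl
prefixSum-+ {suc n} v w zero    = refl
prefixSum-+ {suc n} v w (suc k) =
  trans (cong (v zero + w zero +_) (prefixSum-+ (v ∘ suc) (w ∘ suc) k))
        (+-interchange (v zero) (w zero) _ _)

prefixSum-sum-comm : ∀ {m n} (f : Fin m → Fin n → ℕ) k →
                     prefixSum (λ j → sum (λ i → f i j)) k ≡ sum (λ i → prefixSum (f i) k)
prefixSum-sum-comm {m} {zero}  f k       = sym (sum-replicate-zero m)
prefixSum-sum-comm {m} {suc n} f zero    = sym (sum-replicate-zero m)
prefixSum-sum-comm {m} {suc n} f (suc k) =
  trans (cong (sum (λ i → f i zero) +_) (prefixSum-sum-comm (λ i j → f i (suc j)) k))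
        (sym (∑-distrib-+ (λ i → f i zero) (λ i → prefixSum (f i ∘ suc) k)))

prefixSum≡sum-𝟙 : ∀ {n} (v : Fin n → ℕ) k → prefixSum v k ≡ sum (λ i → 𝟙 (toℕ i <? k) * v i)
prefixSum≡sum-𝟙 {zero}  v k       = refl
prefixSum≡sum-𝟙 {suc n} v zero    = sym (sum-replicate-zero (suc n))
prefixSum≡sum-𝟙 {suc n} v (suc k) =
  cong₂ _+_ (sym (+-identityʳ (v zero))) (prefixSum≡sum-𝟙 (v ∘ suc) k)

prefixSum-toℕ∘opposite : ∀ {n k} → k ≤ n →
                         prefixSum (toℕ ∘ opposite {n}) k ≡ sum {n} (λ i → toℕ i ⊓ k)
prefixSum-toℕ∘opposite {n} z≤n =
  trans (prefixSum-zero (toℕ ∘ opposite {n})) (sym (sum-zero {n} (⊓-zeroʳ ∘ toℕ)))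
prefixSum-toℕ∘opposite {suc n} {suc k} (s≤s k≤n) = begin
  toℕ (opposite {suc n} zero) + prefixSum (toℕ ∘ opposite {suc n} ∘ suc) k
    ≡⟨ cong₂ _+_ (toℕ-fromℕ n) (prefixSum-cong (opposite-suc {n}) k) ⟩
  n + prefixSum (toℕ ∘ opposite {n}) k ≡⟨ cong (n +_) (prefixSum-toℕ∘opposite k≤n) ⟩
  n + sum {n} (λ i → toℕ i ⊓ k)        ≡⟨ sum-suc {n} (λ i → toℕ i ⊓ k) ⟨
  sum {n} (λ i → suc (toℕ i ⊓ k))      ∎
  where open ≡-Reasoning

-- Ranks in 0-1 vectors

rank : ∀ {n} → (Fin n → ℕ) → Fin n → ℕ
rank v i = prefixSum v (toℕ i)

rank<prefixSum-suc : ∀ {n} (v : Fin n → ℕ) i → 0 < v i → rank v i < prefixSum v (suc (toℕ i))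
rank<prefixSum-suc v i 0<vi =
  subst (rank v i <_) (sym (prefixSum-suc v i)) (m<m+n (rank v i) 0<vi)

rank<sum : ∀ {n} (v : Fin n → ℕ) i → 0 < v i → rank v i < sum v
rank<sum v i 0<vi = <-≤-trans (rank<prefixSum-suc v i 0<vi) (prefixSum≤sum v _)

ones-of-rank : ∀ {n} {v : Fin n → ℕ} → Is01 v → ∀ p →
               sum (λ i → v i * 𝟙 (rank v i ≟ p)) ≡ 𝟙 (p <? sum v)
ones-of-rank {zero}      v01 p = refl
ones-of-rank {suc n} {v} v01 p with v zero | v01 zero
... | zero        | _      = ones-of-rank (v01 ∘ suc) p
... | suc (suc _) | s≤s ()
... | suc zero    | _ with p
...   | zero  = cong suc (sum-zero (λ i → *-zeroʳ (v (suc i))))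
...   | suc p = ones-of-rank (v01 ∘ suc) p

rankMatch : ∀ {n} (v w : Fin n → ℕ) → Fin n → Fin n → ℕ
rankMatch v w i m = v i * w m * 𝟙 (rank v i ≟ rank w m)

rankMatch-comm : ∀ {n} (v w : Fin n → ℕ) i m → rankMatch v w i m ≡ rankMatch w v m i
rankMatch-comm v w i m =
  cong₂ _*_ (*-comm (v i) (w m)) (𝟙-⇔ sym sym (rank v i ≟ rank w m) (rank w m ≟ rank v i))

rankMatch≤1 : ∀ {n} {v w : Fin n → ℕ} → Is01 v → Is01 w → ∀ i m → rankMatch v w i m ≤ 1
rankMatch≤1 {v = v} {w} v01 w01 i m =
  *-mono-≤ (*-mono-≤ (v01 i) (w01 m)) (𝟙≤1 (rank v i ≟ rank w m))

rankMatch-rowSum : ∀ {n} {v w : Fin n → ℕ} → Is01 w → sum v ≡ sum w → ∀ i →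
                   sum (rankMatch v w i) ≡ v i
rankMatch-rowSum {v = v} {w} w01 Σv≡Σw i = begin
  sum (rankMatch v w i)                             ≡⟨ sum-cong-≗ (λ m → *-assoc (v i) (w m) _) ⟩
  sum (λ m → v i * (w m * 𝟙 (rank v i ≟ rank w m)))
                                                    ≡⟨ *-distribˡ-sum (v i) (λ m → w m * 𝟙 (rank v i ≟ rank w m)) ⟨
  v i * sum (λ m → w m * 𝟙 (rank v i ≟ rank w m))   ≡⟨ cong (v i *_) (sum-cong-≗ (λ m → cong (w m *_)
                                                         (𝟙-⇔ sym sym (rank v i ≟ rank w m) (rank w m ≟ rank v i)))) ⟩
  v i * sum (λ m → w m * 𝟙 (rank w m ≟ rank v i))   ≡⟨ cong (v i *_) (ones-of-rank w01 (rank v i)) ⟩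
  v i * 𝟙 (rank v i <? sum w)                       ≡⟨ m*𝟙≡m (v i) (rank v i <? sum w)
                                                         (subst (rank v i <_) Σv≡Σw ∘ rank<sum v i) ⟩
  v i                                               ∎
  where open ≡-Reasoning

rankMatch-colSum : ∀ {n} {v w : Fin n → ℕ} → Is01 v → sum v ≡ sum w → ∀ m →
                   sum (λ i → rankMatch v w i m) ≡ w m
rankMatch-colSum {v = v} {w} v01 Σv≡Σw m =
  trans (sum-cong-≗ (λ i → rankMatch-comm v w i m)) (rankMatch-rowSum v01 (sym Σv≡Σw) m)

rankMatch-below : ∀ {n} {v w : Fin n → ℕ} → w ⪯ v → ∀ {i m} → toℕ m < toℕ i →
                  rankMatch v w i m ≡ 0
rankMatch-below {v = v} {w} w⪯v {i} {m} m<i with w m in wm≡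
... | zero  = cong (_* 𝟙 (rank v i ≟ rank w m)) (*-zeroʳ (v i))
... | suc k = trans (cong (v i * suc k *_) (𝟙-no (rank v i ≟ rank w m) (<⇒≢ rank-m<rank-i ∘ sym)))
                    (*-zeroʳ (v i * suc k))
  where
  rank-m<rank-i : rank w m < rank v i
  rank-m<rank-i = <-≤-trans (rank<prefixSum-suc w m (subst (0 <_) (sym wm≡) z<s))
    (≤-trans (prefixSum-monoʳ-≤ w m<i) (w⪯v (toℕ i) (<⇒≤ (toℕ<n i))))

-- The upper-left n × n block of a realization of ASM(γ, δ), with 0-based indices.
IsCore : ∀ {n} → (γ δ : Fin n → ℕ) → (Fin n → Fin n → ℕ) → Set
IsCore γ δ Q = (∀ i j → Q i j ≤ 1)
             × (∀ i → sum (Q i) ≡ toℕ i + γ i)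
             × (∀ j → sum (λ i → Q i j) ≡ toℕ j + δ j)

minorization⇒core : ∀ {n} {γ δ : Fin n → ℕ} → Is01 γ → Is01 δ → sum γ ≡ sum δ → rev δ ⪯ γ →
                    ∃ (IsCore γ δ)
minorization⇒core {n} {γ} {δ} γ01 δ01 Σγ≡Σδ rev⪯γ =
  (λ i j → skew i (opposite j)) , (λ i j → skew≤1 (toℕ (opposite j) <? toℕ i)) , rowSums , colSums
  where
  open ≡-Reasoning

  Σγ≡Σrevδ : sum γ ≡ sum (rev δ)
  Σγ≡Σrevδ = trans Σγ≡Σδ (sum-permute δ reverse)

  skew : Fin n → Fin n → ℕ
  skew i m = 𝟙 (toℕ m <? toℕ i) + rankMatch γ (rev δ) i m

  skew≤1 : ∀ {i m} (m<?i : Dec (toℕ m < toℕ i)) → 𝟙 m<?i + rankMatch γ (rev δ) i m ≤ 1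
  skew≤1 (yes m<i) = ≤-reflexive (cong suc (rankMatch-below rev⪯γ m<i))
  skew≤1 (no _)    = rankMatch≤1 γ01 (δ01 ∘ opposite) _ _

  rowSums : ∀ i → sum (λ j → skew i (opposite j)) ≡ toℕ i + γ i
  rowSums i = begin
    sum (λ j → skew i (opposite j))
      ≡⟨ sum-permute (skew i) reverse ⟨
    sum (skew i)
      ≡⟨ ∑-distrib-+ (λ m → 𝟙 (toℕ m <? toℕ i)) (rankMatch γ (rev δ) i) ⟩
    sum {n} (λ m → 𝟙 (toℕ m <? toℕ i)) + sum (rankMatch γ (rev δ) i)
      ≡⟨ cong₂ _+_ (count-below i) (rankMatch-rowSum (δ01 ∘ opposite) Σγ≡Σrevδ i) ⟩
    toℕ i + γ i
      ∎

  colSums : ∀ j → sum (λ i → skew i (opposite j)) ≡ toℕ j + δ j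
  colSums j = begin
    sum (λ i → skew i (opposite j))
      ≡⟨ ∑-distrib-+ (λ i → 𝟙 (toℕ (opposite j) <? toℕ i)) (λ i → rankMatch γ (rev δ) i (opposite j)) ⟩
    sum {n} (λ i → 𝟙 (toℕ (opposite j) <? toℕ i)) + sum (λ i → rankMatch γ (rev δ) i (opposite j))
      ≡⟨ cong₂ _+_ (count-above (opposite j)) (rankMatch-colSum γ01 Σγ≡Σrevδ (opposite j)) ⟩
    toℕ (opposite (opposite j)) + δ (opposite (opposite j))
      ≡⟨ cong (λ k → toℕ k + δ k) (opposite-involutive j) ⟩
    toℕ j + δ j
      ∎

core⇒minorization : ∀ {n} {γ δ : Fin n → ℕ} {Q : Fin n → Fin n → ℕ} → IsCore γ δ Q → rev δ ⪯ γ
core⇒minorization {n} {γ} {δ} {Q} (Q01 , rowSums , colSums) k k≤n =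
  +-cancelˡ-≤ (prefixSum (toℕ ∘ opposite {n}) k) _ _ (begin
    prefixSum (toℕ ∘ opposite {n}) k + prefixSum (rev δ) k
      ≡⟨ prefixSum-+ (toℕ ∘ opposite) (rev δ) k ⟨
    prefixSum (λ m → toℕ (opposite m) + δ (opposite m)) k
      ≡⟨ prefixSum-cong (colSums ∘ opposite) k ⟨
    prefixSum (λ m → sum (λ i → Q i (opposite m))) k
      ≡⟨ prefixSum-sum-comm (λ i m → Q i (opposite m)) k ⟩
    sum (λ i → prefixSum (λ m → Q i (opposite m)) k)
      ≤⟨ sum-mono-≤ (λ i → rowBound i (toℕ i <? k)) ⟩
    sum (λ i → toℕ i ⊓ k + 𝟙 (toℕ i <? k) * γ i)
      ≡⟨ ∑-distrib-+ (λ i → toℕ i ⊓ k) (λ i → 𝟙 (toℕ i <? k) * γ i) ⟩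
    sum {n} (λ i → toℕ i ⊓ k) + sum (λ i → 𝟙 (toℕ i <? k) * γ i)
      ≡⟨ cong₂ _+_ (prefixSum-toℕ∘opposite k≤n) (prefixSum≡sum-𝟙 γ k) ⟨
    prefixSum (toℕ ∘ opposite {n}) k + prefixSum γ k
      ∎)
  where
  open ≤-Reasoning
  rowBound : ∀ i (i<?k : Dec (toℕ i < k)) →
             prefixSum (λ m → Q i (opposite m)) k ≤ toℕ i ⊓ k + 𝟙 i<?k * γ i
  rowBound i (yes i<k) = begin
    prefixSum (λ m → Q i (opposite m)) k  ≤⟨ prefixSum≤sum (λ m → Q i (opposite m)) k ⟩
    sum (λ m → Q i (opposite m))          ≡⟨ sum-permute (Q i) reverse ⟨
    sum (Q i)                             ≡⟨ rowSums i ⟩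
    toℕ i + γ i                           ≡⟨ cong₂ _+_ (m≤n⇒m⊓n≡m (<⇒≤ i<k)) (+-identityʳ (γ i)) ⟨
    toℕ i ⊓ k + (γ i + 0)                 ∎
  rowBound i (no i≮k) = begin
    prefixSum (λ m → Q i (opposite m)) k  ≤⟨ prefixSum≤length (λ m → Q01 i (opposite m)) k ⟩
    k                                     ≡⟨ trans (+-identityʳ (toℕ i ⊓ k)) (m≥n⇒m⊓n≡n (≮⇒≥ i≮k)) ⟨
    toℕ i ⊓ k + 0                         ∎

-- inner i, outer₁ and outer₂ are the indices i + 1, n + 1 and n + 2 of the paper.
data Pos (n : ℕ) : Set where
  inner         : Fin n → Pos n
  outer₁ outer₂ : Pos n

toFin : ∀ {n} → Pos n → Fin (suc (suc n))
toFin {zero}  outer₁          = zero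
toFin {zero}  outer₂          = suc zero
toFin {suc n} (inner zero)    = zero
toFin {suc n} (inner (suc i)) = suc (toFin (inner i))
toFin {suc n} outer₁          = suc (toFin {n} outer₁)
toFin {suc n} outer₂          = suc (toFin {n} outer₂)

shift : ∀ {n} → Pos n → Pos (suc n)
shift (inner i) = inner (suc i)
shift outer₁    = outer₁
shift outer₂    = outer₂

fromFin : ∀ {n} → Fin (suc (suc n)) → Pos n
fromFin {zero}  zero    = outer₁
fromFin {zero}  (suc _) = outer₂
fromFin {suc n} zero    = inner zero
fromFin {suc n} (suc x) = shift (fromFin x)

toFin-shift : ∀ {n} (p : Pos n) → toFin (shift p) ≡ suc (toFin p)
toFin-shift (inner i) = refl
toFin-shift outer₁    = refl
toFin-shift outer₂    = refl

toFin-fromFin : ∀ {n} (x : Fin (suc (suc n))) → toFin (fromFin x) ≡ x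
toFin-fromFin {zero}  zero       = refl
toFin-fromFin {zero}  (suc zero) = refl
toFin-fromFin {suc n} zero       = refl
toFin-fromFin {suc n} (suc x)    = trans (toFin-shift (fromFin x)) (cong suc (toFin-fromFin x))

fromFin-toFin : ∀ {n} (p : Pos n) → fromFin (toFin p) ≡ p
fromFin-toFin {zero}  outer₁          = refl
fromFin-toFin {zero}  outer₂          = refl
fromFin-toFin {suc n} (inner zero)    = refl
fromFin-toFin {suc n} (inner (suc i)) = cong shift (fromFin-toFin (inner i))
fromFin-toFin {suc n} outer₁          = cong shift (fromFin-toFin {n} outer₁)
fromFin-toFin {suc n} outer₂          = cong shift (fromFin-toFin {n} outer₂)

sumPos : ∀ {n} → (Pos n → ℕ) → ℕ
sumPos g = sum (g ∘ inner) + g outer₁ + g outer₂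

sumPos-cong : ∀ {n} {g h : Pos n → ℕ} → (∀ p → g p ≡ h p) → sumPos g ≡ sumPos h
sumPos-cong g≗h = cong₂ _+_ (cong₂ _+_ (sum-cong-≗ (g≗h ∘ inner)) (g≗h outer₁)) (g≗h outer₂)

sum≡sumPos : ∀ {n} (f : Fin (suc (suc n)) → ℕ) → sum f ≡ sumPos (f ∘ toFin)
sum≡sumPos {zero}  f = cong (f zero +_) (+-identityʳ (f (suc zero)))
sum≡sumPos {suc n} f = begin
  f zero + sum (f ∘ suc)
    ≡⟨ cong (f zero +_) (sum≡sumPos (f ∘ suc)) ⟩
  f zero + (sum (f ∘ toFin ∘ inner ∘ suc) + f (toFin outer₁) + f (toFin outer₂))
    ≡⟨ +-assoc (f zero) _ _ ⟨
  f zero + (sum (f ∘ toFin ∘ inner ∘ suc) + f (toFin outer₁)) + f (toFin outer₂)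
    ≡⟨ cong (_+ f (toFin outer₂)) (+-assoc (f zero) _ _) ⟨
  sumPos (f ∘ toFin)
    ∎
  where open ≡-Reasoning

term≤sumPos : ∀ {n} (g : Pos n → ℕ) p → g p ≤ sumPos g
term≤sumPos g (inner i) =
  ≤-trans (term≤sum (g ∘ inner) i) (≤-trans (m≤m+n _ (g outer₁)) (m≤m+n _ (g outer₂)))
term≤sumPos g outer₁    = ≤-trans (m≤n+m (g outer₁) (sum (g ∘ inner))) (m≤m+n _ (g outer₂))
term≤sumPos g outer₂    = m≤n+m (g outer₂) (sum (g ∘ inner) + g outer₁)

extend : ∀ {n} {A : Set} → (Fin n → A) → A → A → Pos n → A
extend v x y (inner i) = v i
extend v x y outer₁    = x
extend v x y outer₂    = y

extend2-toFin : ∀ {n} (v : Fin n → ℕ) x y p → extend2 v x y (toFin p) ≡ extend v x y p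
extend2-toFin {zero}  v x y outer₁          = refl
extend2-toFin {zero}  v x y outer₂          = refl
extend2-toFin {suc n} v x y (inner zero)    = refl
extend2-toFin {suc n} v x y (inner (suc i)) = extend2-toFin (v ∘ suc) x y (inner i)
extend2-toFin {suc n} v x y outer₁          = extend2-toFin (v ∘ suc) x y outer₁
extend2-toFin {suc n} v x y outer₂          = extend2-toFin (v ∘ suc) x y outer₂

-- Realizations of ASM(γ, δ)

count : Atom → Cell → ℕ
count t = isCell (atomCell t)

asmLine : (n K : ℕ) → (Fin n → ℕ) → Atom → Pos n → ℕ
asmLine n K β azure = extend (azureBase n) 0 K
asmLine n K β beige = extend β 2 (n ∸ K + 2)
asmLine n K β cyan  = λ _ → 0

rowSum-ASM : ∀ {n K} {γ δ : Fin n → ℕ} t p →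
             Instance.rowSum (ASM n K γ δ) t (toFin p) ≡ asmLine n K γ t p
rowSum-ASM azure p = extend2-toFin _ 0 _ p
rowSum-ASM beige p = extend2-toFin _ 2 _ p
rowSum-ASM cyan  p = refl

colSum-ASM : ∀ {n K} {γ δ : Fin n → ℕ} t p →
             Instance.colSum (ASM n K γ δ) t (toFin p) ≡ asmLine n K δ t p
colSum-ASM azure p = extend2-toFin _ 0 _ p
colSum-ASM beige p = extend2-toFin _ 2 _ p
colSum-ASM cyan  p = refl

realization-transpose : ∀ {n K} {γ δ : Fin n → ℕ} {M : Matrix (suc (suc n))} →
                        IsRealization (ASM n K γ δ) M → IsRealization (ASM n K δ γ) (flip M)
realization-transpose (rows , cols) =
  (λ { azure → cols azure ; beige → cols beige ; cyan → cols cyan }) ,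
  (λ { azure → rows azure ; beige → rows beige ; cyan → rows cyan })

rowCount≡sumPos : ∀ {n} (M : Matrix (suc (suc n))) t x →
                  rowCount M t x ≡ sumPos (λ q → count t (M x (toFin q)))
rowCount≡sumPos {n} M t x =
  trans (sumFin≡sum (suc (suc n)) (λ y → count t (M x y))) (sum≡sumPos (λ y → count t (M x y)))

azure+beige≤1 : ∀ c → isCell A c + isCell B c ≤ 1
azure+beige≤1 A = s≤s z≤n
azure+beige≤1 B = s≤s z≤n
azure+beige≤1 C = z≤n
azure+beige≤1 □ = z≤n

azure≤1 : ∀ c → isCell A c ≤ 1
azure≤1 c = ≤-trans (m≤m+n _ _) (azure+beige≤1 c)

beige≤1 : ∀ c → isCell B c ≤ 1
beige≤1 c = ≤-trans (m≤n+m _ _) (azure+beige≤1 c)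

full-line : ∀ {N} (c : Fin N → Cell) → sum (λ y → isCell A (c y)) + sum (λ y → isCell B (c y)) ≡ N →
            ∀ y → isCell A (c y) + isCell B (c y) ≡ 1
full-line {N} c total = sum-≤⇒≗ (λ y → azure+beige≤1 (c y)) (≤-reflexive (begin
  sum {N} (λ _ → 1)                                          ≡⟨ sum-ones N ⟩
  N                                                          ≡⟨ total ⟨
  sum (λ y → isCell A (c y)) + sum (λ y → isCell B (c y))
    ≡⟨ ∑-distrib-+ (λ y → isCell A (c y)) (λ y → isCell B (c y)) ⟨
  sum (λ y → isCell A (c y) + isCell B (c y))                ∎))
  where open ≡-Reasoning

module _ {n K : ℕ} {γ δ : Fin n → ℕ} {M : Matrix (suc (suc n))}
         (K≤n : K ≤ n) (Σδ : sum δ ≡ n ∸ K) (realizes : IsRealization (ASM n K γ δ) M) where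

  private
    cell : Atom → Pos n → Pos n → ℕ
    cell t p q = count t (M (toFin p) (toFin q))

    rowTotal : ∀ t p → sum (λ y → count t (M (toFin p) y)) ≡ asmLine n K γ t p
    rowTotal t p = trans (sym (sumFin≡sum (suc (suc n)) (λ y → count t (M (toFin p) y))))
                         (trans (proj₁ realizes t (toFin p)) (rowSum-ASM {γ = γ} {δ} t p))

    rowTotalPos : ∀ t p → sumPos (cell t p) ≡ asmLine n K γ t p
    rowTotalPos t p = trans (sym (sum≡sumPos (λ y → count t (M (toFin p) y)))) (rowTotal t p)

    colTotalPos : ∀ t q → sumPos (λ p → cell t p q) ≡ asmLine n K δ t q
    colTotalPos t q = trans (sym (rowCount≡sumPos (flip M) t (toFin q)))
                            (trans (proj₂ realizes t (toFin q)) (colSum-ASM {γ = γ} {δ} t q))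

    outer₁-azure : ∀ j → cell azure outer₁ (inner j) ≡ 0
    outer₁-azure j = n≤0⇒n≡0 (≤-trans (term≤sumPos (cell azure outer₁) (inner j))
                                      (≤-reflexive (rowTotalPos azure outer₁)))

    outer₂-beige : ∀ j → cell beige outer₂ (inner j) ≡ δ j
    outer₂-beige = sum-≤⇒≗ below (+-cancelʳ-≤ 2 _ _ (begin
      sum δ + 2                                                ≡⟨ cong (_+ 2) Σδ ⟩
      n ∸ K + 2                                                ≡⟨ rowTotalPos beige outer₂ ⟨
      S + cell beige outer₂ outer₁ + cell beige outer₂ outer₂  ≤⟨ +-mono-≤ (+-monoʳ-≤ S (beige≤1 _)) (beige≤1 _) ⟩
      S + 1 + 1                                                ≡⟨ +-assoc S 1 1 ⟩
      S + 2                                                    ∎))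
      where
      open ≤-Reasoning
      S = sum (λ j → cell beige outer₂ (inner j))
      below : ∀ j → cell beige outer₂ (inner j) ≤ δ j
      below j = ≤-trans (term≤sumPos (λ p → cell beige p (inner j)) outer₂)
                        (≤-reflexive (colTotalPos beige (inner j)))

    outer₂-azure : ∀ j → cell azure outer₂ (inner j) + δ j ≡ 1
    outer₂-azure j = begin
      cell azure outer₂ (inner j) + δ j                            ≡⟨ cong (_ +_) (outer₂-beige j) ⟨
      cell azure outer₂ (inner j) + cell beige outer₂ (inner j)
        ≡⟨ full-line (M (toFin outer₂)) full (toFin (inner j)) ⟩
      1                                                            ∎
      where
      open ≡-Reasoning
      full : sum (λ y → isCell A (M (toFin outer₂) y)) + sum (λ y → isCell B (M (toFin outer₂) y))
           ≡ suc (suc n)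
      full = begin
        sum (λ y → isCell A (M (toFin outer₂) y)) + sum (λ y → isCell B (M (toFin outer₂) y))
                          ≡⟨ cong₂ _+_ (rowTotal azure outer₂) (rowTotal beige outer₂) ⟩
        K + (n ∸ K + 2)   ≡⟨ +-assoc K (n ∸ K) 2 ⟨
        K + (n ∸ K) + 2   ≡⟨ cong (_+ 2) (m+[n∸m]≡n K≤n) ⟩
        n + 2             ≡⟨ +-comm n 2 ⟩
        suc (suc n)       ∎

  inner-column-azure : ∀ j → sum (λ i → count azure (M (toFin (inner i)) (toFin (inner j)))) ≡ toℕ j + δ j
  inner-column-azure j = suc-injective (begin
    suc S                       ≡⟨ +-comm 1 S ⟩
    S + 1                       ≡⟨ cong (S +_) (outer₂-azure j) ⟨
    S + (a₂ + δ j)              ≡⟨ +-assoc S a₂ (δ j) ⟨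
    S + a₂ + δ j                ≡⟨ cong (λ s → s + a₂ + δ j) (+-identityʳ S) ⟨
    S + 0 + a₂ + δ j            ≡⟨ cong (λ a → S + a + a₂ + δ j) (outer₁-azure j) ⟨
    S + a₁ + a₂ + δ j           ≡⟨ cong (_+ δ j) (colTotalPos azure (inner j)) ⟩
    suc (toℕ j) + δ j           ∎)
    where
    open ≡-Reasoning
    S  = sum (λ i → cell azure (inner i) (inner j))
    a₁ = cell azure outer₁ (inner j)
    a₂ = cell azure outer₂ (inner j)

realization⇒core : ∀ {n K} {γ δ : Fin n → ℕ} {M : Matrix (suc (suc n))} → K ≤ n →
                   sum γ ≡ n ∸ K → sum δ ≡ n ∸ K → IsRealization (ASM n K γ δ) M → ∃ (IsCore γ δ)
realization⇒core {M = M} K≤n Σγ Σδ realizes =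
  (λ i j → isCell A (M (toFin (inner i)) (toFin (inner j)))) ,
  (λ i j → azure≤1 _) ,
  inner-column-azure {M = flip M} K≤n Σγ (realization-transpose {M = M} realizes) ,
  inner-column-azure {M = M} K≤n Σδ realizes

-- Extending a core to a realization

azureIf : ℕ → Cell
azureIf zero    = □
azureIf (suc _) = A

beigeElseAzure : ℕ → Cell
beigeElseAzure zero    = A
beigeElseAzure (suc _) = B

azureIf-azure : ∀ {x} → x ≤ 1 → isCell A (azureIf x) ≡ x
azureIf-azure z≤n       = refl
azureIf-azure (s≤s z≤n) = refl

azureIf-beige : ∀ x → isCell B (azureIf x) ≡ 0
azureIf-beige zero    = refl
azureIf-beige (suc _) = refl

azureIf-cyan : ∀ x → isCell C (azureIf x) ≡ 0
azureIf-cyan zero    = refl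
azureIf-cyan (suc _) = refl

beigeElseAzure-azure : ∀ {x} → x ≤ 1 → x + isCell A (beigeElseAzure x) ≡ 1
beigeElseAzure-azure z≤n       = refl
beigeElseAzure-azure (s≤s z≤n) = refl

beigeElseAzure-beige : ∀ {x} → x ≤ 1 → isCell B (beigeElseAzure x) ≡ x
beigeElseAzure-beige z≤n       = refl
beigeElseAzure-beige (s≤s z≤n) = refl

beigeElseAzure-cyan : ∀ x → isCell C (beigeElseAzure x) ≡ 0
beigeElseAzure-cyan zero    = refl
beigeElseAzure-cyan (suc _) = refl

frame : ∀ {n} → (Fin n → Fin n → ℕ) → (γ δ : Fin n → ℕ) → Pos n → Pos n → Cell
frame Q γ δ (inner i) (inner j) = azureIf (Q i j)
frame Q γ δ (inner i) outer₁    = □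
frame Q γ δ (inner i) outer₂    = beigeElseAzure (γ i)
frame Q γ δ outer₁    (inner j) = □
frame Q γ δ outer₂    (inner j) = beigeElseAzure (δ j)
frame Q γ δ _         _         = B

frame-transpose : ∀ {n} (Q : Fin n → Fin n → ℕ) γ δ p q → frame Q γ δ p q ≡ frame (flip Q) δ γ q p
frame-transpose Q γ δ (inner i) (inner j) = refl
frame-transpose Q γ δ (inner i) outer₁    = refl
frame-transpose Q γ δ (inner i) outer₂    = refl
frame-transpose Q γ δ outer₁    (inner j) = refl
frame-transpose Q γ δ outer₁    outer₁    = refl
frame-transpose Q γ δ outer₁    outer₂    = refl
frame-transpose Q γ δ outer₂    (inner j) = refl
frame-transpose Q γ δ outer₂    outer₁    = refl
frame-transpose Q γ δ outer₂    outer₂    = refl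

frame-cyan : ∀ {n} (Q : Fin n → Fin n → ℕ) γ δ p q → count cyan (frame Q γ δ p q) ≡ 0
frame-cyan Q γ δ (inner i) (inner j) = azureIf-cyan (Q i j)
frame-cyan Q γ δ (inner i) outer₁    = refl
frame-cyan Q γ δ (inner i) outer₂    = beigeElseAzure-cyan (γ i)
frame-cyan Q γ δ outer₁    (inner j) = refl
frame-cyan Q γ δ outer₁    outer₁    = refl
frame-cyan Q γ δ outer₁    outer₂    = refl
frame-cyan Q γ δ outer₂    (inner j) = beigeElseAzure-cyan (δ j)
frame-cyan Q γ δ outer₂    outer₁    = refl
frame-cyan Q γ δ outer₂    outer₂    = refl

frame-rowSums : ∀ {n K} {Q : Fin n → Fin n → ℕ} {γ δ : Fin n → ℕ} → K ≤ n → (∀ i j → Q i j ≤ 1) →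
                (∀ i → sum (Q i) ≡ toℕ i + γ i) → Is01 γ → Is01 δ → sum δ ≡ n ∸ K →
                ∀ t p → sumPos (λ q → count t (frame Q γ δ p q)) ≡ asmLine n K γ t p
frame-rowSums {n} {K} {Q} {γ} {δ} K≤n Q01 rowSums γ01 δ01 Σδ = lines
  where
  open ≡-Reasoning
  lines : ∀ t p → sumPos (λ q → count t (frame Q γ δ p q)) ≡ asmLine n K γ t p
  lines azure (inner i) = begin
    sum (λ j → isCell A (azureIf (Q i j))) + 0 + a
      ≡⟨ cong (λ s → s + 0 + a) (trans (sum-cong-≗ (azureIf-azure ∘ Q01 i)) (rowSums i)) ⟩
    toℕ i + γ i + 0 + a    ≡⟨ cong (_+ a) (+-identityʳ _) ⟩
    toℕ i + γ i + a        ≡⟨ +-assoc (toℕ i) (γ i) a ⟩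
    toℕ i + (γ i + a)      ≡⟨ cong (toℕ i +_) (beigeElseAzure-azure (γ01 i)) ⟩
    toℕ i + 1              ≡⟨ +-comm (toℕ i) 1 ⟩
    suc (toℕ i)            ∎
    where a = isCell A (beigeElseAzure (γ i))
  lines beige (inner i) =
    cong₂ (λ s b → s + 0 + b) (sum-zero (azureIf-beige ∘ Q i)) (beigeElseAzure-beige (γ01 i))
  lines azure outer₁ = cong (λ s → s + 0 + 0) (sum-replicate-zero n)
  lines beige outer₁ = cong (λ s → s + 1 + 1) (sum-replicate-zero n)
  lines azure outer₂ = trans (+-identityʳ (X + 0)) (trans (+-identityʳ X) (+-cancelˡ-≡ (n ∸ K) X K (begin
    n ∸ K + X                                           ≡⟨ cong (_+ X) Σδ ⟨
    sum δ + X                                           ≡⟨ ∑-distrib-+ δ (λ j → isCell A (beigeElseAzure (δ j))) ⟨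
    sum (λ j → δ j + isCell A (beigeElseAzure (δ j)))   ≡⟨ sum-cong-≗ (beigeElseAzure-azure ∘ δ01) ⟩
    sum {n} (λ _ → 1)                                   ≡⟨ sum-ones n ⟩
    n                                                   ≡⟨ m+[n∸m]≡n K≤n ⟨
    K + (n ∸ K)                                         ≡⟨ +-comm K (n ∸ K) ⟩
    n ∸ K + K                                           ∎)))
    where X = sum (λ j → isCell A (beigeElseAzure (δ j)))
  lines beige outer₂ =
    trans (+-assoc _ 1 1) (cong (_+ 2) (trans (sum-cong-≗ (beigeElseAzure-beige ∘ δ01)) Σδ))
  lines cyan p =
    trans (sumPos-cong (frame-cyan Q γ δ p)) (cong (λ s → s + 0 + 0) (sum-replicate-zero n))

framed : ∀ {n} → (Pos n → Pos n → Cell) → Matrix (suc (suc n))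
framed c x y = c (fromFin x) (fromFin y)

rowCount-framed : ∀ {n} (c : Pos n → Pos n → Cell) (target : Atom → Fin (suc (suc n)) → ℕ) →
                  (∀ t p → sumPos (λ q → count t (c p q)) ≡ target t (toFin p)) →
                  ∀ t x → rowCount (framed c) t x ≡ target t x
rowCount-framed c target lineSums t x = begin
  rowCount (framed c) t x
    ≡⟨ rowCount≡sumPos (framed c) t x ⟩
  sumPos (λ q → count t (c (fromFin x) (fromFin (toFin q))))
    ≡⟨ sumPos-cong (cong (count t ∘ c (fromFin x)) ∘ fromFin-toFin) ⟩
  sumPos (λ q → count t (c (fromFin x) q))
    ≡⟨ lineSums t (fromFin x) ⟩
  target t (toFin (fromFin x))
    ≡⟨ cong (target t) (toFin-fromFin x) ⟩
  target t x
    ∎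
  where open ≡-Reasoning

core⇒realization : ∀ {n K} {γ δ : Fin n → ℕ} {Q : Fin n → Fin n → ℕ} → K ≤ n → Is01 γ → Is01 δ →
                   sum γ ≡ n ∸ K → sum δ ≡ n ∸ K → IsCore γ δ Q → Consistent (ASM n K γ δ)
core⇒realization {n} {K} {γ} {δ} {Q} K≤n γ01 δ01 Σγ Σδ (Q01 , rowSums , colSums) =
  framed (frame Q γ δ) ,
  rowCount-framed (frame Q γ δ) (Instance.rowSum (ASM n K γ δ)) rowLines ,
  rowCount-framed (flip (frame Q γ δ)) (Instance.colSum (ASM n K γ δ)) colLines
  where
  rowLines : ∀ t p → sumPos (λ q → count t (frame Q γ δ p q)) ≡ Instance.rowSum (ASM n K γ δ) t (toFin p)
  rowLines t p = trans (frame-rowSums K≤n Q01 rowSums γ01 δ01 Σδ t p) (sym (rowSum-ASM t p))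

  colLines : ∀ t p → sumPos (λ q → count t (frame Q γ δ q p)) ≡ Instance.colSum (ASM n K γ δ) t (toFin p)
  colLines t p = trans (sumPos-cong (λ q → cong (count t) (frame-transpose Q γ δ q p)))
                       (trans (frame-rowSums K≤n (flip Q01) colSums δ01 γ01 Σγ t p) (sym (colSum-ASM t p)))

lemma7 : (n K : ℕ) → 1 ≤ n → K ≤ n → (γ δ : Fin n → ℕ) →
         Is01 γ → Is01 δ → sumFin n γ ≡ n ∸ K → sumFin n δ ≡ n ∸ K →
         (Consistent (ASM n K γ δ) ⇔ (rev δ ⪯ γ))
lemma7 n K _ K≤n γ δ γ01 δ01 Σγ Σδ = mk⇔
  (λ (M , realizes) → core⇒minorization (proj₂ (realization⇒core {M = M} K≤n Σγ′ Σδ′ realizes)))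
  (λ rev⪯γ → core⇒realization K≤n γ01 δ01 Σγ′ Σδ′
               (proj₂ (minorization⇒core γ01 δ01 (trans Σγ′ (sym Σδ′)) rev⪯γ)))
  where
  Σγ′ = trans (sym (sumFin≡sum n γ)) Σγ
  Σδ′ = trans (sym (sumFin≡sum n δ)) Σδ
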